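{- Let $(D,r)$ be a rooted digraph that is reduced with respect to Rules 1–4 and in which every cut-edge is branching. Then $\mathrm{maxleaf}(D)\ge\mathrm{cv}(D)+1$.
   Context: A rooted digraph $(D,r)$ is a finite digraph without loops or parallel arcs with a root $r$ of in-degree $0$. A cut-vertex is a vertex $v\ne r$ such that some vertex is unreachable from $r$ in $D-v$; $\mathrm{cv}(D)$ is the number of cut-vertices. A cut-edge is an arc $e$ such that some vertex is unreachable from $r$ in $D-e$; a cut-edge $(u,v)$ is branching if another cut-edge has tail $u$. An outbranching rooted at $r$ is a spanning subgraph whose underlying undirected graph is a tree with arcs oriented away from $r$; leaves are vertices of out-degree $0$ in it; $\mathrm{maxleaf}(D)$ is the maximum number of leaves of such an outbranching. $N^-(x),N^+(x)$ denote in-/out-neighbourhoods. $D$ is reduced with respect to Rules 1–4 if: (1) every vertex is reachable from $r$; (2) no cut-vertex has exactly one incoming arc and no cut-vertex has exactly one outgoing arc; (3) there are no vertices $u_1,\dots,u_5$ with $N^+(u_i)=N^-(u_i)=\{u_{i-1},u_{i+1}\}$ for $i=2,3,4$; (4) there is no vertex $x$ with an in-neighbour $y$ such that every directed path from $r$ to $y$ contains a vertex of $N^-(x)\setminus\{y\}$. -}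

module Defs where

open import Data.Nat using (ℕ; zero; suc; _≤_)
open import Data.Fin using (Fin)
open import Data.Bool using (Bool; true; false; not; if_then_else_)
open import Data.List using (List; []; _∷_; length; map; allFin)
open import Data.Bool.ListAction using (all)
open import Data.Nat.ListAction using (sum)
open import Data.List.Relation.Unary.All using (All)
open import Data.List.Relation.Unary.Unique.Propositional using (Unique)
open import Data.Product using (Σ; ∃; ∃-syntax; _×_; _,_)
open import Data.Sum using (_⊎_)
open import Relation.Nullary using (¬_)
open import Relation.Binary.PropositionalEquality using (_≡_; _≢_)

-- Rooted digraphs on vertex set Fin n.
-- Arcs are given by a Boolean adjacency matrix (so there are no parallel
-- arcs); loops are excluded and the root has in-degree 0.

record RootedDigraph : Set where
  field
    n      : ℕ
    adj    : Fin n → Fin n → Bool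
    noLoop : ∀ v → adj v v ≡ false
    root   : Fin n
    rootIn : ∀ u → adj u root ≡ false

  V : Set
  V = Fin n

  Arc : V → V → Set
  Arc u v = adj u v ≡ true

open RootedDigraph public

data Walk {V : Set} (E : V → V → Set) : V → V → Set where
  []  : ∀ {u} → Walk E u u
  _∷_ : ∀ {u v w} → E u v → Walk E v w → Walk E u w

module _ (D : RootedDigraph) where

  private
    r = root D

  ArcMinusV : V D → V D → V D → Set
  ArcMinusV v a b = Arc D a b × a ≢ v × b ≢ v

  ArcMinusE : V D → V D → V D → V D → Set
  ArcMinusE x y a b = Arc D a b × ¬ (a ≡ x × b ≡ y)

  ArcAvoid : (V D → Set) → V D → V D → Set
  ArcAvoid S a b = Arc D a b × ¬ S a × ¬ S b

  Reachable : V D → Set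
  Reachable w = Walk (Arc D) r w

  CutVertex : V D → Set
  CutVertex v = v ≢ r × ∃[ w ] (w ≢ v × ¬ Walk (ArcMinusV v) r w)

  CutEdge : V D → V D → Set
  CutEdge x y = Arc D x y × ∃[ w ] ¬ Walk (ArcMinusE x y) r w

  BranchingCutEdge : V D → V D → Set
  BranchingCutEdge u v = ∃[ v' ] (v' ≢ v × CutEdge u v')

  ExactlyOneIn : V D → Set
  ExactlyOneIn v = ∃[ u ] (Arc D u v × (∀ u' → Arc D u' v → u' ≡ u))

  ExactlyOneOut : V D → Set
  ExactlyOneOut v = ∃[ w ] (Arc D v w × (∀ w' → Arc D v w' → w' ≡ w))

  Rule1 : Set
  Rule1 = ∀ v → Reachable v

  Rule2 : Set
  Rule2 = ∀ v → CutVertex v → ¬ ExactlyOneIn v × ¬ ExactlyOneOut v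

  InOutNbhdIs : V D → V D → V D → Set
  InOutNbhdIs x a b =
    (∀ w → (Arc D x w → (w ≡ a ⊎ w ≡ b)) × ((w ≡ a ⊎ w ≡ b) → Arc D x w)) ×
    (∀ w → (Arc D w x → (w ≡ a ⊎ w ≡ b)) × ((w ≡ a ⊎ w ≡ b) → Arc D w x))

  Rule3 : Set
  Rule3 = ∀ (u₁ u₂ u₃ u₄ u₅ : V D) →
    Unique (u₁ ∷ u₂ ∷ u₃ ∷ u₄ ∷ u₅ ∷ []) →
    ¬ (InOutNbhdIs u₂ u₁ u₃ × InOutNbhdIs u₃ u₂ u₄ × InOutNbhdIs u₄ u₃ u₅)

  -- "every directed path from r to y contains a vertex of S":
  -- there is no walk from r to y all of whose vertices lie outside S
  EveryPathHits : (V D → Set) → V D → Set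
  EveryPathHits S y = ¬ (¬ S r × Walk (ArcAvoid S) r y)

  Rule4 : Set
  Rule4 = ¬ (∃[ x ] ∃[ y ] (Arc D y x × EveryPathHits (λ z → Arc D z x × z ≢ y) y))

  Reduced : Set
  Reduced = Rule1 × Rule2 × Rule3 × Rule4

  EveryCutEdgeBranching : Set
  EveryCutEdgeBranching = ∀ u v → CutEdge u v → BranchingCutEdge u v

  -- Outbranchings, given as Boolean arc-subsets B of D (Bang-Jensen–Gutin):
  -- spanning subdigraph in which r has in-degree 0, every other vertex has
  -- in-degree exactly 1, and every vertex is reachable from r.

  BArc : (V D → V D → Bool) → V D → V D → Set
  BArc B u v = B u v ≡ true

  IsOutbranching : (V D → V D → Bool) → Set
  IsOutbranching B =
    (∀ u v → BArc B u v → Arc D u v) ×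
    (∀ u → B u r ≡ false) ×
    (∀ v → v ≢ r → ∃[ u ] (BArc B u v × (∀ u' → BArc B u' v → u' ≡ u))) ×
    (∀ v → Walk (BArc B) r v)

  isLeafᵇ : (V D → V D → Bool) → V D → Bool
  isLeafᵇ B v = all (λ w → not (B v w)) (allFin (n D))

  leafCount : (V D → V D → Bool) → ℕ
  leafCount B = sum (map (λ v → if isLeafᵇ B v then 1 else 0) (allFin (n D)))

  MaxLeafAtLeast : ℕ → Set
  MaxLeafAtLeast m = ∃[ B ] (IsOutbranching B × m ≤ leafCount B)

  CvAtLeast : ℕ → Set
  CvAtLeast k = ∃[ cs ] (Unique cs × All CutVertex cs × length cs ≡ k)

module Submission where

-- Let B be any outbranching of D; one exists because every vertex is reachable
-- (take a breadth-first tree). Every cut-edge (u,v) is an arc of B, for otherwise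
-- the walks of B from r would all live in D − (u,v). If v is a cut-vertex, then on
-- a walk from r to a vertex separated by v, the vertex a following the last visit
-- of v is an out-neighbour of v unreachable in D − v. By Rule 4, v is the only
-- in-neighbour of a, so (v,a) is a cut-edge; being branching, it has a sibling
-- cut-edge with tail v. So every cut-vertex has at least two children in B, and as
-- B has n − 1 arcs, summing out-degrees gives n − 1 ≥ (n − #leaves) + cv.

open import Data.Nat using (ℕ; zero; suc; _+_; _≤_; _<_; z≤n; s≤s)
open import Data.Nat.Properties
  using ( +-0-commutativeMonoid; +-mono-≤; +-comm; +-cancelʳ-≤; ≤-refl; ≤-trans; ≮⇒≥
        ; m≤m+n; m≤n+m; module ≤-Reasoning)
open import Data.Fin using (Fin; zero; suc; _≟_)
open import Data.Fin.Properties using (any?)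
open import Data.Bool using (Bool; true; false; not; _∧_; if_then_else_)
import Data.Bool.Properties as Bool
open import Data.List using (List; []; _∷_; length; map; allFin; tabulate)
open import Data.List.Properties using (map-tabulate)
import Data.Nat.ListAction as ListAction
open import Data.List.Relation.Unary.All as All using (All; []; _∷_)
open import Data.List.Relation.Unary.All.Properties using (all⁻; tabulate⁺)
open import Data.List.Relation.Unary.AllPairs using ([]; _∷_)
open import Data.List.Relation.Unary.Unique.Propositional using (Unique)
open import Data.Product using (∃-syntax; ∃₂; _×_; _,_; proj₁; proj₂)
open import Data.Sum using (_⊎_; inj₁; inj₂)
open import Function using (_∘_; id)
open import Function.Bundles using (Equivalence)
open import Relation.Nullary using (¬_; Dec; yes; no; does; contradiction)
open import Relation.Nullary.Decidable using (dec-true; dec-false; _⊎-dec_; _×-dec_)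
open import Relation.Binary.PropositionalEquality
open import Algebra.Properties.CommutativeMonoid.Sum +-0-commutativeMonoid
  using (sum-syntax; ∑-comm; ∑-distrib-+; sum-cong-≗; sum-replicate-zero)
open import Defs

𝟙 : Bool → ℕ
𝟙 b = if b then 1 else 0

∑-mono-≤ : ∀ {n} {f g : Fin n → ℕ} → (∀ i → f i ≤ g i) → ∑[ i < n ] f i ≤ ∑[ i < n ] g i
∑-mono-≤ {zero}  _   = z≤n
∑-mono-≤ {suc n} f≤g = +-mono-≤ (f≤g zero) (∑-mono-≤ (f≤g ∘ suc))

∑-1 : ∀ n → ∑[ i < n ] 1 ≡ n
∑-1 zero    = refl
∑-1 (suc n) = cong suc (∑-1 n)

∑-𝟙-≟ : ∀ {n} (x : Fin n) → ∑[ i < n ] 𝟙 (does (i ≟ x)) ≡ 1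
∑-𝟙-≟ {suc n} zero    = cong suc (sum-replicate-zero n)
∑-𝟙-≟ {suc n} (suc x) = ∑-𝟙-≟ x

sum-tabulate : ∀ {n} (f : Fin n → ℕ) → ListAction.sum (tabulate f) ≡ ∑[ i < n ] f i
sum-tabulate {zero}  f = refl
sum-tabulate {suc n} f = cong (f zero +_) (sum-tabulate (f ∘ suc))

sum-map-allFin : ∀ {n} (f : Fin n → ℕ) → ListAction.sum (map f (allFin n)) ≡ ∑[ i < n ] f i
sum-map-allFin f = trans (cong ListAction.sum (map-tabulate id f)) (sum-tabulate f)

module _ {n : ℕ} where
  open import Data.List.Membership.DecPropositional (_≟_ {n = n}) using (_∈?_)

  𝟙-∈-∷ : ∀ {x : Fin n} {xs} → All (x ≢_) xs → ∀ i →
          𝟙 (does (i ∈? x ∷ xs)) ≡ 𝟙 (does (i ≟ x)) + 𝟙 (does (i ∈? xs))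
  𝟙-∈-∷ {x} {xs} x∉xs i with i ≟ x
  ... | no _     = refl
  ... | yes refl rewrite dec-false (i ∈? xs) (λ i∈xs → All.lookup x∉xs i∈xs refl) = refl

  ∑-𝟙-∈ : ∀ {xs : List (Fin n)} → Unique xs → ∑[ i < n ] 𝟙 (does (i ∈? xs)) ≡ length xs
  ∑-𝟙-∈ {[]}     _              = sum-replicate-zero n
  ∑-𝟙-∈ {x ∷ xs} (x∉xs ∷ uniq) = begin
    ∑[ i < n ] 𝟙 (does (i ∈? x ∷ xs))
      ≡⟨ sum-cong-≗ (𝟙-∈-∷ x∉xs) ⟩
    ∑[ i < n ] (𝟙 (does (i ≟ x)) + 𝟙 (does (i ∈? xs)))
      ≡⟨ ∑-distrib-+ (λ i → 𝟙 (does (i ≟ x))) _ ⟩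
    ∑[ i < n ] 𝟙 (does (i ≟ x)) + ∑[ i < n ] 𝟙 (does (i ∈? xs))
      ≡⟨ cong₂ _+_ (∑-𝟙-≟ x) (∑-𝟙-∈ uniq) ⟩
    1 + length xs ∎
    where open ≡-Reasoning

∃-least : ∀ {P : ℕ → Set} → (∀ k → Dec (P k)) → ∀ {k} → P k →
          ∃[ m ] (P m × (∀ {j} → j < m → ¬ P j))
∃-least P? {zero}  p = 0 , p , λ ()
∃-least P? {suc k} p with P? 0
... | yes p₀ = 0 , p₀ , λ ()
... | no ¬p₀ =
  let m , pm , below = ∃-least (P? ∘ suc) p
  in suc m , pm , λ { {zero} _ → ¬p₀ ; {suc j} (s≤s j<m) → below j<m }

private
  variable
    A : Set
    E F : A → A → Set

infixr 5 _++ʷ_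
infixl 5 _▷_

walk-map : (∀ {a b} → E a b → F a b) → ∀ {s t} → Walk E s t → Walk F s t
walk-map f []       = []
walk-map f (e ∷ es) = f e ∷ walk-map f es

_++ʷ_ : ∀ {s t u} → Walk E s t → Walk E t u → Walk E s u
[]       ++ʷ ws = ws
(e ∷ es) ++ʷ ws = e ∷ (es ++ʷ ws)

_▷_ : ∀ {s t u} → Walk E s t → E t u → Walk E s u
ws ▷ e = ws ++ʷ (e ∷ [])

module _ (D : RootedDigraph) where

  private
    r = root D

  open import Data.List.Membership.DecPropositional (_≟_ {n = n D}) using (_∈?_)

  arc⇒≢ : ∀ {u w} → Arc D u w → u ≢ w
  arc⇒≢ {u} u→u refl with () ← trans (sym (noLoop D u)) u→u

  arc⇒≢root : ∀ {u w} → Arc D u w → w ≢ r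
  arc⇒≢root {u} u→r refl with () ← trans (sym (rootIn D u)) u→r

  parentArcs : (V D → V D) → V D → V D → Bool
  parentArcs p u x = not (does (x ≟ r)) ∧ does (u ≟ p x)

  module _ (p : V D → V D) where

    parentArc : ∀ {x} → x ≢ r → BArc D (parentArcs p) (p x) x
    parentArc {x} x≢r rewrite dec-false (x ≟ r) x≢r | dec-true (p x ≟ p x) refl = refl

    parentArc⁻ : ∀ {u x} → BArc D (parentArcs p) u x → x ≢ r × u ≡ p x
    parentArc⁻ {u} {x} e with x ≟ r | u ≟ p x
    parentArc⁻ ()  | yes _   | _
    parentArc⁻ ()  | no _    | no _
    parentArc⁻ _   | no x≢r  | yes u≡px = x≢r , u≡px

    parentArcs-isOutbranching : (rank : V D → ℕ) →
      (∀ x → x ≢ r → Arc D (p x) x × rank (p x) < rank x) →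
      IsOutbranching D (parentArcs p)
    parentArcs-isOutbranching rank descends =
      inD , noArcToRoot , (λ x x≢r → p x , parentArc x≢r , λ _ → proj₂ ∘ parentArc⁻) ,
      λ x → walkFromRoot (suc (rank x)) x ≤-refl
      where
      inD : ∀ u x → BArc D (parentArcs p) u x → Arc D u x
      inD u x e with parentArc⁻ {u} {x} e
      ... | x≢r , refl = proj₁ (descends x x≢r)

      noArcToRoot : ∀ u → parentArcs p u r ≡ false
      noArcToRoot u rewrite dec-true (r ≟ r) refl = refl

      walkFromRoot : ∀ m x → rank x < m → Walk (BArc D (parentArcs p)) r x
      walkFromRoot (suc m) x (s≤s rank≤m) with x ≟ r
      ... | yes refl = []
      ... | no x≢r   =
        walkFromRoot m (p x) (≤-trans (proj₂ (descends x x≢r)) rank≤m) ▷ parentArc x≢r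

  WithinSteps : ℕ → V D → Set
  WithinSteps zero    x = x ≡ r
  WithinSteps (suc k) x = WithinSteps k x ⊎ ∃[ u ] (WithinSteps k u × Arc D u x)

  withinSteps? : ∀ k x → Dec (WithinSteps k x)
  withinSteps? zero    x = x ≟ r
  withinSteps? (suc k) x =
    withinSteps? k x ⊎-dec any? (λ u → withinSteps? k u ×-dec (adj D u x Bool.≟ true))

  walk⇒withinSteps : ∀ {k s t} → WithinSteps k s → Walk (Arc D) s t → ∃[ j ] WithinSteps j t
  walk⇒withinSteps {k} s∈ []            = k , s∈
  walk⇒withinSteps {s = s} s∈ (s→ ∷ ws) = walk⇒withinSteps (inj₂ (s , s∈ , s→)) ws

  module BreadthFirst (reachable : Rule1 D) where

    leastSteps : ∀ x → ∃[ m ] (WithinSteps m x × (∀ {j} → j < m → ¬ WithinSteps j x))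
    leastSteps x = ∃-least (λ k → withinSteps? k x) (proj₂ (walk⇒withinSteps refl (reachable x)))

    level : V D → ℕ
    level x = proj₁ (leastSteps x)

    level-≤ : ∀ {j x} → WithinSteps j x → level x ≤ j
    level-≤ {x = x} x∈ = ≮⇒≥ (λ j<level → proj₂ (proj₂ (leastSteps x)) j<level x∈)

    lowerInNeighbour : ∀ {x} → x ≢ r → ∃[ u ] (Arc D u x × level u < level x)
    lowerInNeighbour {x} x≢r with leastSteps x
    ... | zero  , x≡r , _                 = contradiction x≡r x≢r
    ... | suc j , inj₁ x∈ , minimal       = contradiction x∈ (minimal ≤-refl)
    ... | suc j , inj₂ (u , u∈ , u→x) , _ = u , u→x , s≤s (level-≤ u∈)

    parent : ∀ x → ∃[ u ] (x ≢ r → Arc D u x × level u < level x)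
    parent x with x ≟ r
    ... | yes x≡r = x , λ x≢r → contradiction x≡r x≢r
    ... | no x≢r  = let u , u→x , lower = lowerInNeighbour x≢r in u , λ _ → u→x , lower

  outbranching-exists : Rule1 D → ∃[ B ] IsOutbranching D B
  outbranching-exists reachable =
    parentArcs (proj₁ ∘ parent) , parentArcs-isOutbranching _ level (proj₂ ∘ parent)
    where open BreadthFirst reachable

  cutEdge⇒outbranchingArc : ∀ {B u v} → IsOutbranching D B → CutEdge D u v → BArc D B u v
  cutEdge⇒outbranchingArc {B} {u} {v} (inD , _ , _ , spanning) (_ , w , unreachable)
    with B u v Bool.≟ true
  ... | yes uv∈B = uv∈B
  ... | no uv∉B  = contradiction (walk-map avoid (spanning w)) unreachable
    where
    avoid : ∀ {a b} → BArc D B a b → ArcMinusE D u v a b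
    avoid {a} {b} ab∈B = inD a b ab∈B , λ { (refl , refl) → uv∉B ab∈B }

  avoiding-source : ∀ {v s w} → Walk (ArcMinusV D v) s w → w ≢ v → s ≢ v
  avoiding-source []                  w≢v = w≢v
  avoiding-source ((_ , s≢v , _) ∷ _) _   = s≢v

  lastExit : ∀ v {s w} → Walk (Arc D) s w → w ≢ v →
             Walk (ArcMinusV D v) s w ⊎ ∃[ a ] (Arc D v a × Walk (ArcMinusV D v) a w)
  lastExit v []             w≢v = inj₁ []
  lastExit v {s} (s→t ∷ ws) w≢v with lastExit v ws w≢v | s ≟ v
  ... | inj₂ exit | _        = inj₂ exit
  ... | inj₁ ws′  | yes refl = inj₂ (_ , s→t , ws′)
  ... | inj₁ ws′  | no s≢v   = inj₁ ((s→t , s≢v , avoiding-source ws′ w≢v) ∷ ws′)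

  cutVertex⇒separatedOutNeighbour : Rule1 D → ∀ {v} → CutVertex D v →
    ∃[ a ] (Arc D v a × ¬ Walk (ArcMinusV D v) r a)
  cutVertex⇒separatedOutNeighbour reachable {v} (_ , w , w≢v , unreachable)
    with lastExit v (reachable w) w≢v
  ... | inj₁ ws              = contradiction ws unreachable
  ... | inj₂ (a , v→a , ws) = a , v→a , λ ws′ → unreachable (ws′ ++ʷ ws)

  separated⇒soleInNeighbour : Rule4 D → ∀ {v a} → Arc D v a → ¬ Walk (ArcMinusV D v) r a →
    ∀ {y} → Arc D y a → y ≡ v
  separated⇒soleInNeighbour rule4 {v} {a} v→a unreachable {y} y→a with y ≟ v
  ... | yes y≡v = y≡v
  ... | no y≢v  = contradiction (a , y , y→a , everyPathHits) rule4
    where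
    S : V D → Set
    S z = Arc D z a × z ≢ y

    avoid : ∀ {b c} → ArcAvoid D S b c → ArcMinusV D v b c
    avoid (b→c , b∉S , c∉S) =
      b→c , (λ { refl → b∉S (v→a , y≢v ∘ sym) }) , (λ { refl → c∉S (v→a , y≢v ∘ sym) })

    everyPathHits : EveryPathHits D S y
    everyPathHits (_ , ws) = unreachable (walk-map avoid ws ▷ (y→a , y≢v , arc⇒≢ v→a ∘ sym))

  soleInNeighbour⇒cutEdge : ∀ {v a} → Arc D v a → (∀ {y} → Arc D y a → y ≡ v) → CutEdge D v a
  soleInNeighbour⇒cutEdge {v} {a} v→a sole =
    v→a , a , λ ws → avoids ws (arc⇒≢root v→a ∘ sym) refl
    where
    avoids : ∀ {s t} → Walk (ArcMinusE D v a) s t → s ≢ a → t ≢ a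
    avoids []                 s≢a = s≢a
    avoids ((b→c , ¬va) ∷ ws) _  = avoids ws (λ { refl → ¬va (sole b→c , refl) })

  cutVertex⇒twoCutEdges : Rule1 D → Rule4 D → EveryCutEdgeBranching D → ∀ {v} → CutVertex D v →
    ∃₂ λ a a′ → a ≢ a′ × CutEdge D v a × CutEdge D v a′
  cutVertex⇒twoCutEdges reachable rule4 branching {v} cv =
    let a , v→a , separated = cutVertex⇒separatedOutNeighbour reachable cv
        cut = soleInNeighbour⇒cutEdge v→a (separated⇒soleInNeighbour rule4 v→a separated)
        a′ , a′≢a , cut′ = branching v a cut
    in a , a′ , a′≢a ∘ sym , cut , cut′

  outdeg : (V D → V D → Bool) → V D → ℕ
  outdeg B v = ∑[ w < n D ] 𝟙 (B v w)

  length≤outdeg : ∀ {B v ws} → Unique ws → All (BArc D B v) ws → length ws ≤ outdeg B v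
  length≤outdeg {B} {v} {ws} uniq children =
    subst (_≤ outdeg B v) (∑-𝟙-∈ uniq) (∑-mono-≤ child)
    where
    child : ∀ w → 𝟙 (does (w ∈? ws)) ≤ 𝟙 (B v w)
    child w with w ∈? ws
    ... | no _    = z≤n
    ... | yes w∈ rewrite All.lookup children w∈ = ≤-refl

  childless⇒isLeaf : ∀ {B v} → (∀ w → ¬ BArc D B v w) → isLeafᵇ D B v ≡ true
  childless⇒isLeaf childless =
    Equivalence.to Bool.T-≡ (all⁻ _ (tabulate⁺ (Equivalence.from Bool.T-not-≡ ∘ Bool.¬-not ∘ childless)))

  leaf-or-child : ∀ B v → 1 ≤ outdeg B v + 𝟙 (isLeafᵇ D B v)
  leaf-or-child B v with any? (λ w → B v w Bool.≟ true)
  ... | yes (w , v→w) = ≤-trans (length≤outdeg {B} {v} ([] ∷ []) (v→w ∷ [])) (m≤m+n _ _)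
  ... | no ¬child     rewrite childless⇒isLeaf {B} {v} (λ w v→w → ¬child (w , v→w)) =
    m≤n+m 1 (outdeg B v)

  module _ {B} (isOutbranching : IsOutbranching D B) where

    private
      noArcToRoot  = proj₁ (proj₂ isOutbranching)
      uniqueParent = proj₁ (proj₂ (proj₂ isOutbranching))

    isRoot+indegree : ∀ w → 𝟙 (does (w ≟ r)) + ∑[ v < n D ] 𝟙 (B v w) ≡ 1
    isRoot+indegree w with w ≟ r
    ... | yes refl = cong suc (trans (sum-cong-≗ (cong 𝟙 ∘ noArcToRoot)) (sum-replicate-zero (n D)))
    ... | no w≢r   = trans (sum-cong-≗ isParent) (∑-𝟙-≟ u)
      where
      u = proj₁ (uniqueParent w w≢r)

      isParent : ∀ v → 𝟙 (B v w) ≡ 𝟙 (does (v ≟ u))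
      isParent v with v ≟ u
      ... | yes refl rewrite proj₁ (proj₂ (uniqueParent w w≢r)) = refl
      ... | no v≢u   rewrite Bool.¬-not (v≢u ∘ proj₂ (proj₂ (uniqueParent w w≢r)) v) = refl

    1+∑outdeg : 1 + ∑[ v < n D ] outdeg B v ≡ n D
    1+∑outdeg = begin
      1 + ∑[ v < n D ] ∑[ w < n D ] 𝟙 (B v w)
        ≡⟨ cong₂ _+_ (sym (∑-𝟙-≟ r)) (∑-comm (λ v w → 𝟙 (B v w))) ⟩
      ∑[ w < n D ] 𝟙 (does (w ≟ r)) + ∑[ w < n D ] ∑[ v < n D ] 𝟙 (B v w)
        ≡⟨ sym (∑-distrib-+ (λ w → 𝟙 (does (w ≟ r))) _) ⟩
      ∑[ w < n D ] (𝟙 (does (w ≟ r)) + ∑[ v < n D ] 𝟙 (B v w))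
        ≡⟨ sum-cong-≗ isRoot+indegree ⟩
      ∑[ w < n D ] 1
        ≡⟨ ∑-1 (n D) ⟩
      n D ∎
      where open ≡-Reasoning

    leafCount-bound : ∀ {cs} → Unique cs → All (λ v → 2 ≤ outdeg B v) cs →
                      suc (length cs) ≤ leafCount D B
    leafCount-bound {cs} uniq branchy = +-cancelʳ-≤ O (suc (length cs)) (leafCount D B) (begin
      suc (length cs) + O
        ≡⟨ cong suc (+-comm (length cs) O) ⟩
      (1 + O) + length cs
        ≡⟨ cong₂ _+_ (trans 1+∑outdeg (sym (∑-1 (n D)))) (sym (∑-𝟙-∈ uniq)) ⟩
      ∑[ v < n D ] 1 + ∑[ v < n D ] 𝟙 (does (v ∈? cs))
        ≡⟨ sym (∑-distrib-+ (λ _ → 1) (λ v → 𝟙 (does (v ∈? cs)))) ⟩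
      ∑[ v < n D ] (1 + 𝟙 (does (v ∈? cs)))
        ≤⟨ ∑-mono-≤ perVertex ⟩
      ∑[ v < n D ] (outdeg B v + 𝟙 (isLeafᵇ D B v))
        ≡⟨ ∑-distrib-+ (outdeg B) _ ⟩
      O + ∑[ v < n D ] 𝟙 (isLeafᵇ D B v)
        ≡⟨ +-comm O _ ⟩
      ∑[ v < n D ] 𝟙 (isLeafᵇ D B v) + O
        ≡⟨ cong (_+ O) (sym (sum-map-allFin (𝟙 ∘ isLeafᵇ D B))) ⟩
      leafCount D B + O ∎)
      where
      open ≤-Reasoning
      O = ∑[ v < n D ] outdeg B v

      perVertex : ∀ v → 1 + 𝟙 (does (v ∈? cs)) ≤ outdeg B v + 𝟙 (isLeafᵇ D B v)
      perVertex v with v ∈? cs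
      ... | yes v∈cs = ≤-trans (All.lookup branchy v∈cs) (m≤m+n _ _)
      ... | no _     = leaf-or-child B v

  cutVertex⇒outdeg≥2 : Rule1 D → Rule4 D → EveryCutEdgeBranching D →
    ∀ {B v} → IsOutbranching D B → CutVertex D v → 2 ≤ outdeg B v
  cutVertex⇒outdeg≥2 reachable rule4 branching {B} {v} isOutbranching cv =
    let a , a′ , a≢a′ , cut , cut′ = cutVertex⇒twoCutEdges reachable rule4 branching cv
    in length≤outdeg {B} {v} ((a≢a′ ∷ []) ∷ [] ∷ [])
         (cutEdge⇒outbranchingArc isOutbranching cut ∷ cutEdge⇒outbranchingArc isOutbranching cut′ ∷ [])

lemma23 : (D : RootedDigraph) → Reduced D → EveryCutEdgeBranching D →
    ∀ (k : ℕ) → CvAtLeast D k → MaxLeafAtLeast D (suc k)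
lemma23 D (reachable , _ , _ , rule4) branching _ (cs , uniq , cutVertices , refl) =
  let B , isOutbranching = outbranching-exists D reachable
  in B , isOutbranching ,
     leafCount-bound D isOutbranching uniq
       (All.map (cutVertex⇒outdeg≥2 D reachable rule4 branching isOutbranching) cutVertices)
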